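{- For any finite binary trees $t_1$ and $t_2$, $\widetilde{\langle t_1,t_2\rangle}=\widetilde{t_1}\oplus\widetilde{t_2}$.
   Context: Finite binary trees are the variable-free terms built from a constant $\bot$ and a binary function symbol $\langle\cdot,\cdot\rangle$. For a tree $t$ let $\widehat{t}$ be its Polish notation string over $\{a,b\}$: $\widehat{\bot}=a$, $\widehat{\langle t_1,t_2\rangle}=b\,\widehat{t_1}\,\widehat{t_2}$. The snake $\tilde t$ of $t$: if $\widehat t=a$ then $\tilde t=(0)$; if $\widehat t=\alpha_1\cdots\alpha_n$ with $n>1$, $\alpha_i\in\{a,b\}$, then $\tilde t=(x_1,\dots,x_n)$ with $x_1=2$ and $x_{i+1}=x_i-1$ if $\alpha_{i+1}=a$, $x_{i+1}=x_i+1$ if $\alpha_{i+1}=b$ ($i=1,\dots,n-1$). For finite sequences of naturals, $(x_1,\dots,x_n)\oplus(y_1,\dots,y_m)=(2,x_1+1,\dots,x_n+1,y_1,\dots,y_m)$. -}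

module Defs where

open import Data.Nat using (ℕ; suc; _∸_)
open import Data.List using (List; []; _∷_; map; _++_)

-- finite binary trees: ⊥ and ⟨ t₁ , t₂ ⟩
data Tree : Set where
  leaf : Tree
  node : Tree → Tree → Tree

data AB : Set where
  a b : AB

polish : Tree → List AB
polish leaf = a ∷ []
polish (node t₁ t₂) = b ∷ (polish t₁ ++ polish t₂)

-- the walk x₂ … xₙ following x₁ = x, given α₂ … αₙ
walk : ℕ → List AB → List ℕ
walk x [] = []
walk x (a ∷ αs) = (x ∸ 1) ∷ walk (x ∸ 1) αs
walk x (b ∷ αs) = suc x ∷ walk (suc x) αs

snakeWord : List AB → List ℕ
snakeWord [] = []
snakeWord (α ∷ []) = 0 ∷ []
snakeWord (α ∷ αs@(_ ∷ _)) = 2 ∷ walk 2 αs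

snake : Tree → List ℕ
snake t = snakeWord (polish t)

_⊕_ : List ℕ → List ℕ → List ℕ
xs ⊕ ys = 2 ∷ (map suc xs ++ ys)

-- The Polish word of a tree has one more a than b, and every proper prefix has at
-- least as many b as a.  So the walk along it started at height y + 1 ends at y and
-- never reaches the truncation of ∸; consequently walks concatenate along
-- t₁ followed by t₂, and raising the start by one raises every height by one.  The
-- snake is the walk started at 1, whose first b-step gives the leading 2.
module Submission where

open import Defs
open import Data.Nat using (ℕ; suc; _∸_)
open import Data.List using (List; []; _∷_; map; _++_; foldl)
open import Data.List.Properties using (foldl-++; map-++)
open import Relation.Binary.PropositionalEquality
  using (_≡_; refl; cong; cong₂; sym; module ≡-Reasoning)
open ≡-Reasoning

step : ℕ → AB → ℕ
step x a = x ∸ 1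
step x b = suc x

walkEnd : ℕ → List AB → ℕ
walkEnd = foldl step

walk-++ : ∀ x αs βs → walk x (αs ++ βs) ≡ walk x αs ++ walk (walkEnd x αs) βs
walk-++ x []       βs = refl
walk-++ x (a ∷ αs) βs = cong ((x ∸ 1) ∷_) (walk-++ (x ∸ 1) αs βs)
walk-++ x (b ∷ αs) βs = cong (suc x ∷_) (walk-++ (suc x) αs βs)

walkEnd-polish : ∀ t y → walkEnd (suc y) (polish t) ≡ y
walkEnd-polish leaf       y = refl
walkEnd-polish (node u v) y = begin
  walkEnd (suc (suc y)) (polish u ++ polish v)          ≡⟨ foldl-++ step (suc (suc y)) (polish u) (polish v) ⟩
  walkEnd (walkEnd (suc (suc y)) (polish u)) (polish v) ≡⟨ cong (λ z → walkEnd z (polish v)) (walkEnd-polish u (suc y)) ⟩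
  walkEnd (suc y) (polish v)                            ≡⟨ walkEnd-polish v y ⟩
  y                                                     ∎

walk-polish-++ : ∀ t y w → walk (suc y) (polish t ++ w) ≡ walk (suc y) (polish t) ++ walk y w
walk-polish-++ t y w = begin
  walk (suc y) (polish t ++ w)                                   ≡⟨ walk-++ (suc y) (polish t) w ⟩
  walk (suc y) (polish t) ++ walk (walkEnd (suc y) (polish t)) w ≡⟨ cong (λ z → walk (suc y) (polish t) ++ walk z w) (walkEnd-polish t y) ⟩
  walk (suc y) (polish t) ++ walk y w                            ∎

walk-suc-polish : ∀ t y → walk (suc (suc y)) (polish t) ≡ map suc (walk (suc y) (polish t))
walk-suc-polish leaf       y = refl
walk-suc-polish (node u v) y = cong (suc (suc (suc y)) ∷_) (begin
  walk (3+ y) (polish u ++ polish v)                        ≡⟨ walk-polish-++ u (suc (suc y)) (polish v) ⟩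
  walk (3+ y) (polish u) ++ walk (suc (suc y)) (polish v)   ≡⟨ cong₂ _++_ (walk-suc-polish u (suc y)) (walk-suc-polish v y) ⟩
  map suc (walk (suc (suc y)) (polish u))
    ++ map suc (walk (suc y) (polish v))                    ≡⟨ sym (map-++ suc (walk (suc (suc y)) (polish u)) _) ⟩
  map suc (walk (suc (suc y)) (polish u) ++ walk (suc y) (polish v))
                                                            ≡⟨ cong (map suc) (sym (walk-polish-++ u (suc y) (polish v))) ⟩
  map suc (walk (suc (suc y)) (polish u ++ polish v))       ∎)
  where
  3+ : ℕ → ℕ
  3+ n = suc (suc (suc n))

walk-one-polish : ∀ t → walk 1 (polish t) ≡ snake t
walk-one-polish leaf                = refl
walk-one-polish (node leaf v)       = refl
walk-one-polish (node (node u w) v) = refl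

lemma10 : (t₁ t₂ : Tree) → snake (node t₁ t₂) ≡ snake t₁ ⊕ snake t₂
lemma10 t₁ t₂ = begin
  snake (node t₁ t₂)                                        ≡⟨ sym (walk-one-polish (node t₁ t₂)) ⟩
  2 ∷ walk 2 (polish t₁ ++ polish t₂)                       ≡⟨ cong (2 ∷_) (walk-polish-++ t₁ 1 (polish t₂)) ⟩
  2 ∷ (walk 2 (polish t₁) ++ walk 1 (polish t₂))            ≡⟨ cong (λ xs → 2 ∷ (xs ++ walk 1 (polish t₂))) (walk-suc-polish t₁ 0) ⟩
  2 ∷ (map suc (walk 1 (polish t₁)) ++ walk 1 (polish t₂))  ≡⟨ cong₂ (λ xs ys → 2 ∷ (map suc xs ++ ys)) (walk-one-polish t₁) (walk-one-polish t₂) ⟩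
  snake t₁ ⊕ snake t₂                                       ∎
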